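{- Let $\mathfrak{X}=\{\bm{x}_1,\ldots,\bm{x}_s\}$ and $\mathfrak{Y}=\{\bm{y}_1,\ldots,\bm{y}_s\}$ be two sets of pairwise incomparable vectors in $\mathbb{Z}^n$ (resp. $\mathbb{Z}^{n'}$) such that the posets $\mathrm{cl}(\mathfrak{X})$ and $\mathrm{cl}(\mathfrak{Y})$ are isomorphic, i.e., there is a bijection $\psi:\mathrm{cl}(\mathfrak{X})\to\mathrm{cl}(\mathfrak{Y})$ with $\bm{x}\le\bm{x}'$ if and only if $\psi(\bm{x})\le\psi(\bm{x}')$. Let $\delta$ be the signed domination function of $\mathrm{cl}(\mathfrak{X})$ and $\gamma$ that of $\mathrm{cl}(\mathfrak{Y})$. Then $\gamma(\psi(\bm{x}))=\delta(\bm{x})$ for all $\bm{x}\in\mathrm{cl}(\mathfrak{X})$.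
   Context: Vectors are ordered componentwise: $\bm{y}\le\bm{x}$ iff $y_i\le x_i$ for all $i$; $\bm{x}\vee\bm{y}=(x_1\vee y_1,\ldots,x_n\vee y_n)$ with $\vee$ the maximum. Two distinct vectors are incomparable if neither is $\le$ the other. For a set $\mathfrak{X}$ of pairwise incomparable vectors, $\mathrm{cl}(\mathfrak{X})$ is the smallest set of vectors containing $\mathfrak{X}$ and closed under $\vee$; it is a poset under the componentwise order. A formation of $\bm{x}\in\mathrm{cl}(\mathfrak{X})$ is a nonempty subset $\{\bm{x}_{i_1},\ldots,\bm{x}_{i_j}\}\subseteq\mathfrak{X}$ with $\bm{x}=\bm{x}_{i_1}\vee\cdots\vee\bm{x}_{i_j}$; it is odd if $j$ is odd and even if $j$ is even. The signed domination function of $\mathrm{cl}(\mathfrak{X})$ is $\delta(\bm{x})=$ (number of odd formations of $\bm{x}$) $-$ (number of even formations of $\bm{x}$). -}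

module Defs where

open import Data.Nat as ℕ using (ℕ; zero; suc)
open import Data.Integer as ℤ using (ℤ; _⊔_; +_; -_)
open import Data.Fin using (Fin; zero; suc)
open import Data.Fin.Subset using (Subset; inside; outside; ∣_∣)
open import Data.Vec as V using (Vec; []; _∷_; zipWith)
open import Data.Vec.Properties using (≡-dec)
open import Data.Vec.Relation.Binary.Pointwise.Inductive using (Pointwise)
open import Data.List as L using (List; []; _∷_; foldr; map; _++_)
open import Data.Maybe using (Maybe; just; nothing)
open import Data.Product using (Σ; ∃; _×_; _,_)
import Data.Bool
open Data.Bool using (if_then_else_)
open import Relation.Nullary using (¬_; Dec; yes; no)
open import Relation.Binary.PropositionalEquality using (_≡_; _≢_)

Vecℤ : ℕ → Set
Vecℤ n = Vec ℤ n

_≤ᵥ_ : ∀ {n} → Vecℤ n → Vecℤ n → Set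
_≤ᵥ_ = Pointwise ℤ._≤_

_∨ᵥ_ : ∀ {n} → Vecℤ n → Vecℤ n → Vecℤ n
_∨ᵥ_ = zipWith _⊔_

PairwiseIncomparable : ∀ {s n} → (Fin s → Vecℤ n) → Set
PairwiseIncomparable X = ∀ i j → i ≢ j → ¬ (X i ≤ᵥ X j)

allSubsets : ∀ s → List (Subset s)
allSubsets zero = [] ∷ []
allSubsets (suc s) = map (inside ∷_) (allSubsets s) ++ map (outside ∷_) (allSubsets s)

members : ∀ {s} → Subset s → List (Fin s)
members [] = []
members (inside ∷ p) = zero ∷ map suc (members p)
members (outside ∷ p) = map suc (members p)

joinList : ∀ {n} → List (Vecℤ n) → Maybe (Vecℤ n)
joinList [] = nothing
joinList (v ∷ vs) = just (foldr _∨ᵥ_ v vs)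

joinOf : ∀ {s n} → (Fin s → Vecℤ n) → Subset s → Maybe (Vecℤ n)
joinOf X S = joinList (map X (members S))

-- S is a formation of x: S nonempty and x = ⋁_{i ∈ S} x_i
IsFormation : ∀ {s n} → (Fin s → Vecℤ n) → Subset s → Vecℤ n → Set
IsFormation X S x = joinOf X S ≡ just x

InCl : ∀ {s n} → (Fin s → Vecℤ n) → Vecℤ n → Set
InCl {s} X x = ∃ λ (S : Subset s) → IsFormation X S x

isFormation? : ∀ {s n} (X : Fin s → Vecℤ n) S x → Dec (IsFormation X S x)
isFormation? X S x with joinOf X S
... | nothing = no (λ ())
... | just y with ≡-dec ℤ._≟_ y x
...   | yes Relation.Binary.PropositionalEquality.refl = yes Relation.Binary.PropositionalEquality.refl
...   | no ne = no (λ { Relation.Binary.PropositionalEquality.refl → ne Relation.Binary.PropositionalEquality.refl })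

odd : ℕ → Data.Bool.Bool
odd zero = Data.Bool.false
odd (suc k) = Data.Bool.not (odd k)

sign : ℕ → ℤ
sign k = if odd k then + 1 else - (+ 1)

contrib : ∀ {s n} → (Fin s → Vecℤ n) → Vecℤ n → Subset s → ℤ
contrib X x S with isFormation? X S x
... | yes _ = sign ∣ S ∣
... | no _ = + 0

δ : ∀ {s n} → (Fin s → Vecℤ n) → Vecℤ n → ℤ
δ {s} X x = L.foldr ℤ._+_ (+ 0) (map (contrib X x) (allSubsets s))

-- The generators x₁, …, x_s are pairwise incomparable, so they are exactly the
-- minimal elements of cl(𝔛); an order isomorphism preserves minimal elements,
-- hence ψ permutes the generators: ψ(xᵢ) = y_{π(i)}.  It also preserves joins,
-- hence S is a formation of x iff π(S) is a formation of ψ(x).  Since S ↦ π(S) is a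
-- cardinality-preserving bijection on subsets, reindexing the signed sum by it
-- turns γ(ψ(x)) into δ(x).
module Submission where

open import Defs
import Data.Nat as ℕ
open import Data.Integer as ℤ using (ℤ; +_)
import Data.Integer.Properties as ℤ
open import Data.Fin using (Fin; zero; suc; _≟_)
open import Data.Fin.Properties using (suc-injective)
open import Data.Fin.Permutation
  using (Permutation′; permutation; flip; _⟨$⟩ʳ_; _⟨$⟩ˡ_; inverseˡ; inverseʳ)
open import Data.Fin.Subset using (Subset; inside; outside; ∣_∣; _∈_; Nonempty; ⁅_⁆; ⊥)
open import Data.Vec using ([]; _∷_; here; there; lookup; tabulate)
open import Data.Vec.Properties
  using (∷-injectiveʳ; lookup∘tabulate; tabulate∘lookup; tabulate-cong; []=⇒lookup; lookup⇒[]=)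
open import Data.Vec.Relation.Binary.Pointwise.Inductive as Pointwise using ([]; _∷_)
open import Data.List using (List; []; _∷_; foldr; map; length)
open import Data.List.Properties using (length-map; map-∘; map-cong)
open import Data.List.Membership.Propositional using () renaming (_∈_ to _∈ₗ_)
open import Data.List.Membership.Propositional.Properties using (∈-map⁺; ∈-map⁻; ∈-++⁺ˡ; ∈-++⁺ʳ)
open import Data.List.Membership.Propositional.Properties.WithK using (unique∧set⇒bag)
open import Data.List.Relation.Unary.Any using () renaming (here to hereₗ; there to thereₗ)
open import Data.List.Relation.Unary.All as All using ()
open import Data.List.Relation.Unary.AllPairs using ([]; _∷_)
open import Data.List.Relation.Unary.Unique.Propositional using (Unique)
import Data.List.Relation.Unary.Unique.Propositional.Properties as Unique
open import Data.List.Relation.Binary.BagAndSetEquality using (∼bag⇒↭)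
open import Data.List.Relation.Binary.Permutation.Propositional using (_↭_; ↭⇒↭ₛ)
open import Data.List.Relation.Binary.Permutation.Propositional.Properties using (↭-length; map⁺)
open import Data.List.Relation.Binary.Permutation.Setoid.Properties using (foldr-commMonoid)
open import Data.Maybe using (just)
open import Data.Product using (∃; _×_; _,_; proj₁; proj₂)
open import Data.Empty using (⊥-elim)
open import Function using (_∘_; _↔_; Inverse; Injection; _⇔_; Equivalence; mk⇔; mk↔ₛ′)
open import Function.Properties.Inverse using (↔⇒↣)
open import Relation.Nullary using (¬_; yes; no)
open import Relation.Binary.PropositionalEquality

open Inverse using (to; from)

≤ᵥ-refl : ∀ {n} {x : Vecℤ n} → x ≤ᵥ x
≤ᵥ-refl = Pointwise.refl ℤ.≤-refl

≤ᵥ-trans : ∀ {n} {x y z : Vecℤ n} → x ≤ᵥ y → y ≤ᵥ z → x ≤ᵥ z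
≤ᵥ-trans = Pointwise.trans ℤ.≤-trans

≤ᵥ-antisym : ∀ {n} {x y : Vecℤ n} → x ≤ᵥ y → y ≤ᵥ x → x ≡ y
≤ᵥ-antisym [] [] = refl
≤ᵥ-antisym (p ∷ ps) (q ∷ qs) = cong₂ _∷_ (ℤ.≤-antisym p q) (≤ᵥ-antisym ps qs)

∨ᵥ-upperˡ : ∀ {n} (x y : Vecℤ n) → x ≤ᵥ (x ∨ᵥ y)
∨ᵥ-upperˡ [] [] = []
∨ᵥ-upperˡ (a ∷ x) (b ∷ y) = ℤ.i≤i⊔j a b ∷ ∨ᵥ-upperˡ x y

∨ᵥ-upperʳ : ∀ {n} (x y : Vecℤ n) → y ≤ᵥ (x ∨ᵥ y)
∨ᵥ-upperʳ [] [] = []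
∨ᵥ-upperʳ (a ∷ x) (b ∷ y) = ℤ.i≤j⊔i a b ∷ ∨ᵥ-upperʳ x y

∨ᵥ-lub : ∀ {n} {x y z : Vecℤ n} → x ≤ᵥ z → y ≤ᵥ z → (x ∨ᵥ y) ≤ᵥ z
∨ᵥ-lub [] [] = []
∨ᵥ-lub (p ∷ ps) (q ∷ qs) = ℤ.⊔-lub p q ∷ ∨ᵥ-lub ps qs

foldr-∨ᵥ-upper : ∀ {n} (v : Vecℤ n) vs {u} → u ∈ₗ v ∷ vs → u ≤ᵥ foldr _∨ᵥ_ v vs
foldr-∨ᵥ-upper v []       (hereₗ refl)           = ≤ᵥ-refl
foldr-∨ᵥ-upper v (w ∷ ws) (hereₗ refl)           =
  ≤ᵥ-trans (foldr-∨ᵥ-upper v ws (hereₗ refl)) (∨ᵥ-upperʳ w _)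
foldr-∨ᵥ-upper v (w ∷ ws) (thereₗ (hereₗ refl))  = ∨ᵥ-upperˡ w _
foldr-∨ᵥ-upper v (w ∷ ws) (thereₗ (thereₗ u∈ws)) =
  ≤ᵥ-trans (foldr-∨ᵥ-upper v ws (thereₗ u∈ws)) (∨ᵥ-upperʳ w _)

foldr-∨ᵥ-least : ∀ {n} (v : Vecℤ n) vs {z} →
                 (∀ {u} → u ∈ₗ v ∷ vs → u ≤ᵥ z) → foldr _∨ᵥ_ v vs ≤ᵥ z
foldr-∨ᵥ-least v []       ub = ub (hereₗ refl)
foldr-∨ᵥ-least v (w ∷ ws) {z} ub = ∨ᵥ-lub (ub (thereₗ (hereₗ refl))) (foldr-∨ᵥ-least v ws ub′)
  where
  ub′ : ∀ {u} → u ∈ₗ v ∷ ws → u ≤ᵥ z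
  ub′ (hereₗ refl)  = ub (hereₗ refl)
  ub′ (thereₗ u∈ws) = ub (thereₗ (thereₗ u∈ws))

joinList-upper : ∀ {n} {vs : List (Vecℤ n)} {r u} → joinList vs ≡ just r → u ∈ₗ vs → u ≤ᵥ r
joinList-upper {vs = v ∷ vs} refl = foldr-∨ᵥ-upper v vs

joinList-least : ∀ {n} {vs : List (Vecℤ n)} {r z} →
                 joinList vs ≡ just r → (∀ {u} → u ∈ₗ vs → u ≤ᵥ z) → r ≤ᵥ z
joinList-least {vs = v ∷ vs} refl = foldr-∨ᵥ-least v vs

joinList-nonempty : ∀ {n} {vs : List (Vecℤ n)} {r} → joinList vs ≡ just r → ∃ λ u → u ∈ₗ vs
joinList-nonempty {vs = v ∷ _} _ = v , hereₗ refl

joinList-defined : ∀ {n} {vs : List (Vecℤ n)} {u} → u ∈ₗ vs → ∃ λ r → joinList vs ≡ just r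
joinList-defined {vs = _ ∷ _} _ = _ , refl

∈-members⁺ : ∀ {s} {S : Subset s} {i} → i ∈ S → i ∈ₗ members S
∈-members⁺ {S = inside ∷ S}  here       = hereₗ refl
∈-members⁺ {S = inside ∷ S}  (there i∈) = thereₗ (∈-map⁺ suc (∈-members⁺ i∈))
∈-members⁺ {S = outside ∷ S} (there i∈) = ∈-map⁺ suc (∈-members⁺ i∈)

∈-members⁻ : ∀ {s} (S : Subset s) {i} → i ∈ₗ members S → i ∈ S
∈-members⁻ (inside ∷ S) (hereₗ refl) = here
∈-members⁻ (inside ∷ S) (thereₗ i∈) with ∈-map⁻ suc i∈
... | j , j∈ , refl = there (∈-members⁻ S j∈)
∈-members⁻ (outside ∷ S) i∈ with ∈-map⁻ suc i∈
... | j , j∈ , refl = there (∈-members⁻ S j∈)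

members-unique : ∀ {s} (S : Subset s) → Unique (members S)
members-unique []            = []
members-unique (inside ∷ S)  = All.tabulate zero≢ ∷ Unique.map⁺ suc-injective (members-unique S)
  where
  zero≢ : ∀ {i} → i ∈ₗ map suc (members S) → zero ≢ i
  zero≢ i∈ with ∈-map⁻ suc i∈
  ... | _ , _ , refl = λ ()
members-unique (outside ∷ S) = Unique.map⁺ suc-injective (members-unique S)

∣∣≡length-members : ∀ {s} (S : Subset s) → ∣ S ∣ ≡ length (members S)
∣∣≡length-members []            = refl
∣∣≡length-members (inside ∷ S)  =
  cong ℕ.suc (trans (∣∣≡length-members S) (sym (length-map suc (members S))))
∣∣≡length-members (outside ∷ S) = trans (∣∣≡length-members S) (sym (length-map suc (members S)))

members-⊥ : ∀ s → members (⊥ {s}) ≡ []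
members-⊥ ℕ.zero    = refl
members-⊥ (ℕ.suc s) = cong (map suc) (members-⊥ s)

members-⁅⁆ : ∀ {s} (i : Fin s) → members ⁅ i ⁆ ≡ i ∷ []
members-⁅⁆ zero    = cong (λ is → zero ∷ map suc is) (members-⊥ _)
members-⁅⁆ (suc i) = cong (map suc) (members-⁅⁆ i)

UpperBound : ∀ {s n} → (Fin s → Vecℤ n) → Subset s → Vecℤ n → Set
UpperBound Z S z = ∀ {i} → i ∈ S → Z i ≤ᵥ z

module _ {s n} {Z : Fin s → Vecℤ n} (S : Subset s) where

  formation-upper : ∀ {x} → IsFormation Z S x → UpperBound Z S x
  formation-upper fx i∈S = joinList-upper fx (∈-map⁺ Z (∈-members⁺ i∈S))

  formation-least : ∀ {x z} → IsFormation Z S x → UpperBound Z S z → x ≤ᵥ z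
  formation-least {z = z} fx ub = joinList-least fx below
    where
    below : ∀ {u} → u ∈ₗ map Z (members S) → u ≤ᵥ z
    below u∈ with ∈-map⁻ Z u∈
    ... | i , i∈ , refl = ub (∈-members⁻ S i∈)

  formation-nonempty : ∀ {x} → IsFormation Z S x → Nonempty S
  formation-nonempty fx with ∈-map⁻ Z (proj₂ (joinList-nonempty fx))
  ... | i , i∈ , _ = i , ∈-members⁻ S i∈

  formation-exists : Nonempty S → ∃ (IsFormation Z S)
  formation-exists (i , i∈S) = joinList-defined (∈-map⁺ Z (∈-members⁺ i∈S))

generator∈cl : ∀ {s n} (Z : Fin s → Vecℤ n) i → InCl Z (Z i)
generator∈cl Z i = ⁅ i ⁆ , cong (joinList ∘ map Z) (members-⁅⁆ i)

InCl⇒generator≤ : ∀ {s n} {Z : Fin s → Vecℤ n} {y} → InCl Z y → ∃ λ k → Z k ≤ᵥ y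
InCl⇒generator≤ (S , fy) with formation-nonempty S fy
... | k , k∈S = k , formation-upper S fy k∈S

module _ {s n} {Z : Fin s → Vecℤ n} (incomparable : PairwiseIncomparable Z) where

  incomparable-≤⇒≡ : ∀ {i j} → Z i ≤ᵥ Z j → i ≡ j
  incomparable-≤⇒≡ {i} {j} Zi≤Zj with i ≟ j
  ... | yes i≡j = i≡j
  ... | no  i≢j = ⊥-elim (incomparable i j i≢j Zi≤Zj)

  incomparable-injective : ∀ {i j} → Z i ≡ Z j → i ≡ j
  incomparable-injective {i} Zi≡Zj = incomparable-≤⇒≡ (subst (Z i ≤ᵥ_) Zi≡Zj ≤ᵥ-refl)

  generator-minimal : ∀ {y i} → InCl Z y → y ≤ᵥ Z i → y ≡ Z i
  generator-minimal cy y≤Zi with InCl⇒generator≤ cy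
  ... | k , Zk≤y with incomparable-≤⇒≡ (≤ᵥ-trans Zk≤y y≤Zi)
  ...   | refl = ≤ᵥ-antisym y≤Zi Zk≤y

image : ∀ {s} → Permutation′ s → Subset s → Subset s
image ρ S = tabulate (λ j → lookup S (ρ ⟨$⟩ˡ j))

module _ {s} (ρ : Permutation′ s) where

  ∈-image⁺ : ∀ {S i} → i ∈ S → ρ ⟨$⟩ʳ i ∈ image ρ S
  ∈-image⁺ {S} {i} i∈S = lookup⇒[]= _ (image ρ S)
    (trans (lookup∘tabulate _ (ρ ⟨$⟩ʳ i)) (trans (cong (lookup S) (inverseˡ ρ)) ([]=⇒lookup i∈S)))

  ∈-image⁻ : ∀ {S j} → j ∈ image ρ S → ρ ⟨$⟩ˡ j ∈ S
  ∈-image⁻ {S} {j} j∈ = lookup⇒[]= _ S (trans (sym (lookup∘tabulate _ j)) ([]=⇒lookup j∈))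

  image-flip : ∀ S → image (flip ρ) (image ρ S) ≡ S
  image-flip S =
    trans (tabulate-cong λ i → trans (lookup∘tabulate _ (ρ ⟨$⟩ʳ i)) (cong (lookup S) (inverseˡ ρ)))
          (tabulate∘lookup S)

  members-image : ∀ S → members (image ρ S) ↭ map (ρ ⟨$⟩ʳ_) (members S)
  members-image S = ∼bag⇒↭ (unique∧set⇒bag (members-unique (image ρ S))
    (Unique.map⁺ (Injection.injective (↔⇒↣ ρ)) (members-unique S)) (mk⇔ ⊆ ⊇))
    where
    ⊆ : ∀ {j} → j ∈ₗ members (image ρ S) → j ∈ₗ map (ρ ⟨$⟩ʳ_) (members S)
    ⊆ {j} j∈ = subst (_∈ₗ _) (inverseʳ ρ) (∈-map⁺ _ (∈-members⁺ (∈-image⁻ {S} (∈-members⁻ _ j∈))))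
    ⊇ : ∀ {j} → j ∈ₗ map (ρ ⟨$⟩ʳ_) (members S) → j ∈ₗ members (image ρ S)
    ⊇ j∈ with ∈-map⁻ _ j∈
    ... | i , i∈ , refl = ∈-members⁺ (∈-image⁺ (∈-members⁻ S i∈))

  ∣image∣ : ∀ S → ∣ image ρ S ∣ ≡ ∣ S ∣
  ∣image∣ S = begin
    ∣ image ρ S ∣                        ≡⟨ ∣∣≡length-members (image ρ S) ⟩
    length (members (image ρ S))         ≡⟨ ↭-length (members-image S) ⟩
    length (map (ρ ⟨$⟩ʳ_) (members S))  ≡⟨ length-map _ (members S) ⟩
    length (members S)                   ≡⟨ ∣∣≡length-members S ⟨
    ∣ S ∣                                ∎
    where open ≡-Reasoning

imageᵢ : ∀ {s} → Permutation′ s → Subset s ↔ Subset s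
imageᵢ ρ = mk↔ₛ′ (image ρ) (image (flip ρ)) (image-flip (flip ρ)) (image-flip ρ)

allSubsets-complete : ∀ {s} (S : Subset s) → S ∈ₗ allSubsets s
allSubsets-complete []                      = hereₗ refl
allSubsets-complete (inside ∷ S)            = ∈-++⁺ˡ (∈-map⁺ (inside ∷_) (allSubsets-complete S))
allSubsets-complete {ℕ.suc s} (outside ∷ S) =
  ∈-++⁺ʳ (map (inside ∷_) (allSubsets s)) (∈-map⁺ (outside ∷_) (allSubsets-complete S))

allSubsets-unique : ∀ s → Unique (allSubsets s)
allSubsets-unique ℕ.zero    = All.[] ∷ []
allSubsets-unique (ℕ.suc s) =
  Unique.++⁺ (Unique.map⁺ ∷-injectiveʳ (allSubsets-unique s))
             (Unique.map⁺ ∷-injectiveʳ (allSubsets-unique s))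
             disjoint
  where
  disjoint : ∀ {S} → ¬ (S ∈ₗ map (inside ∷_) (allSubsets s) × S ∈ₗ map (outside ∷_) (allSubsets s))
  disjoint (S∈ , S∈′) with ∈-map⁻ _ S∈ | ∈-map⁻ _ S∈′
  ... | _ , _ , refl | _ , _ , ()

sumℤ : List ℤ → ℤ
sumℤ = foldr ℤ._+_ (+ 0)

sumℤ-↭ : ∀ {xs ys} → xs ↭ ys → sumℤ xs ≡ sumℤ ys
sumℤ-↭ xs↭ys = foldr-commMonoid (setoid ℤ) ℤ.+-0-isCommutativeMonoid (↭⇒↭ₛ xs↭ys)

sumℤ-allSubsets-reindex : ∀ {s} (h : Subset s ↔ Subset s) (f : Subset s → ℤ) →
                          sumℤ (map f (allSubsets s)) ≡ sumℤ (map (f ∘ to h) (allSubsets s))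
sumℤ-allSubsets-reindex {s} h f = begin
  sumℤ (map f (allSubsets s))                 ≡⟨ sumℤ-↭ (map⁺ f h[all]↭all) ⟨
  sumℤ (map f (map (to h) (allSubsets s)))    ≡⟨ cong sumℤ (map-∘ (allSubsets s)) ⟨
  sumℤ (map (f ∘ to h) (allSubsets s))        ∎
  where
  open ≡-Reasoning
  h[all]↭all : map (to h) (allSubsets s) ↭ allSubsets s
  h[all]↭all = ∼bag⇒↭ (unique∧set⇒bag
    (Unique.map⁺ (Injection.injective (↔⇒↣ h)) (allSubsets-unique s)) (allSubsets-unique s)
    λ {S} → mk⇔ (λ _ → allSubsets-complete S)
                (λ _ → subst (_∈ₗ _) (Inverse.strictlyInverseˡ h S)
                             (∈-map⁺ (to h) (allSubsets-complete (from h S)))))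

contrib-cong : ∀ {s n n′} {X : Fin s → Vecℤ n} {Y : Fin s → Vecℤ n′} {S T x y} →
               (IsFormation X S x ⇔ IsFormation Y T y) → ∣ T ∣ ≡ ∣ S ∣ → contrib Y y T ≡ contrib X x S
contrib-cong {X = X} {Y} {S} {T} {x} {y} S⇔T ∣T∣≡∣S∣ with isFormation? X S x | isFormation? Y T y
... | yes _  | yes _  = cong sign ∣T∣≡∣S∣
... | yes fx | no ¬fy = ⊥-elim (¬fy (Equivalence.to S⇔T fx))
... | no ¬fx | yes fy = ⊥-elim (¬fx (Equivalence.from S⇔T fy))
... | no _   | no _   = refl

module OrderIsomorphism
  {s n n′} {X : Fin s → Vecℤ n} {Y : Fin s → Vecℤ n′} {ψ : Vecℤ n → Vecℤ n′}
  (incX : PairwiseIncomparable X) (incY : PairwiseIncomparable Y)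
  (ψ-into : ∀ x → InCl X x → InCl Y (ψ x))
  (ψ-injective : ∀ x x′ → InCl X x → InCl X x′ → ψ x ≡ ψ x′ → x ≡ x′)
  (ψ-onto : ∀ y → InCl Y y → ∃ λ x → InCl X x × ψ x ≡ y)
  (ψ-≤⇔ : ∀ x x′ → InCl X x → InCl X x′ → (x ≤ᵥ x′) ⇔ (ψ x ≤ᵥ ψ x′))
  where

  ψ-mono : ∀ {x x′} → InCl X x → InCl X x′ → x ≤ᵥ x′ → ψ x ≤ᵥ ψ x′
  ψ-mono cx cx′ = Equivalence.to (ψ-≤⇔ _ _ cx cx′)

  ψ-reflects : ∀ {x x′} → InCl X x → InCl X x′ → ψ x ≤ᵥ ψ x′ → x ≤ᵥ x′
  ψ-reflects cx cx′ = Equivalence.from (ψ-≤⇔ _ _ cx cx′)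

  -- A generator Y k below ψ (X i) pulls back to an element of cl(X) below X i,
  -- which by minimality is X i itself.
  ψ-generator : ∀ i → ∃ λ k → ψ (X i) ≡ Y k
  ψ-generator i =
    let k , Yk≤ψXi = InCl⇒generator≤ (ψ-into _ (generator∈cl X i))
        x , cx , ψx≡Yk = ψ-onto (Y k) (generator∈cl Y k)
        x≤Xi = ψ-reflects cx (generator∈cl X i) (subst (_≤ᵥ ψ (X i)) (sym ψx≡Yk) Yk≤ψXi)
    in k , trans (cong ψ (sym (generator-minimal incX cx x≤Xi))) ψx≡Yk

  π : Fin s → Fin s
  π i = proj₁ (ψ-generator i)

  ψ-X : ∀ i → ψ (X i) ≡ Y (π i)
  ψ-X i = proj₂ (ψ-generator i)

  π-injective : ∀ {i j} → π i ≡ π j → i ≡ j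
  π-injective {i} {j} πi≡πj = incomparable-injective incX
    (ψ-injective _ _ (generator∈cl X i) (generator∈cl X j)
      (trans (ψ-X i) (trans (cong Y πi≡πj) (sym (ψ-X j)))))

  π-surjective : ∀ k → ∃ λ i → π i ≡ k
  π-surjective k =
    let x , cx , ψx≡Yk = ψ-onto (Y k) (generator∈cl Y k)
        i , Xi≤x = InCl⇒generator≤ cx
    in i , incomparable-≤⇒≡ incY (subst₂ _≤ᵥ_ (ψ-X i) ψx≡Yk (ψ-mono (generator∈cl X i) cx Xi≤x))

  ρ : Permutation′ s
  ρ = permutation π (proj₁ ∘ π-surjective) (proj₂ ∘ π-surjective)
                    (λ i → π-injective (proj₂ (π-surjective (π i))))

  ψ-upperBound : ∀ {S z} → InCl X z → UpperBound X S z → UpperBound Y (image ρ S) (ψ z)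
  ψ-upperBound {z = z} cz ub {j} j∈ =
    subst (_≤ᵥ ψ z) (trans (ψ-X (ρ ⟨$⟩ˡ j)) (cong Y (inverseʳ ρ)))
      (ψ-mono (generator∈cl X _) cz (ub (∈-image⁻ ρ j∈)))

  ψ-upperBound⁻ : ∀ {S z} → InCl X z → UpperBound Y (image ρ S) (ψ z) → UpperBound X S z
  ψ-upperBound⁻ {z = z} cz ub {i} i∈ =
    ψ-reflects (generator∈cl X i) cz (subst (_≤ᵥ ψ z) (sym (ψ-X i)) (ub (∈-image⁺ ρ i∈)))

  formation-image-unique : ∀ S {x x′} → IsFormation X S x → InCl X x′ →
                           IsFormation Y (image ρ S) (ψ x′) → x′ ≡ x
  formation-image-unique S {x} {x′} fx cx′ fψx′ = ≤ᵥ-antisym x′≤x x≤x′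
    where
    cx : InCl X x
    cx = S , fx
    x≤x′ : x ≤ᵥ x′
    x≤x′ = formation-least S fx (ψ-upperBound⁻ cx′ (formation-upper (image ρ S) fψx′))
    x′≤x : x′ ≤ᵥ x
    x′≤x = ψ-reflects cx′ cx (formation-least (image ρ S) fψx′ (ψ-upperBound cx (formation-upper S fx)))

  -- The join of π(S) exists and lies in cl(Y), so it is ψ of some element of cl(X).
  formation-image : ∀ S {x} → IsFormation X S x → IsFormation Y (image ρ S) (ψ x)
  formation-image S fx =
    let i , i∈S = formation-nonempty S fx
        v , fv = formation-exists {Z = Y} (image ρ S) (ρ ⟨$⟩ʳ i , ∈-image⁺ ρ i∈S)
        x′ , cx′ , ψx′≡v = ψ-onto v (image ρ S , fv)
        fψx′ = subst (IsFormation Y (image ρ S)) (sym ψx′≡v) fv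
    in subst (IsFormation Y (image ρ S) ∘ ψ) (formation-image-unique S fx cx′ fψx′) fψx′

  formation-image⁻ : ∀ S {x} → InCl X x → IsFormation Y (image ρ S) (ψ x) → IsFormation X S x
  formation-image⁻ S cx fψx =
    let j , j∈ = formation-nonempty (image ρ S) fψx
        w , fw = formation-exists {Z = X} S (ρ ⟨$⟩ˡ j , ∈-image⁻ ρ j∈)
    in subst (IsFormation X S) (sym (formation-image-unique S fw cx fψx)) fw

  δ-ψ≡δ : ∀ x → InCl X x → δ Y (ψ x) ≡ δ X x
  δ-ψ≡δ x cx = begin
    sumℤ (map (contrib Y (ψ x)) (allSubsets s))
      ≡⟨ sumℤ-allSubsets-reindex (imageᵢ ρ) _ ⟩
    sumℤ (map (contrib Y (ψ x) ∘ image ρ) (allSubsets s))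
      ≡⟨ cong sumℤ (map-cong contrib-image (allSubsets s)) ⟩
    sumℤ (map (contrib X x) (allSubsets s))
      ∎
    where
    open ≡-Reasoning
    contrib-image : ∀ S → contrib Y (ψ x) (image ρ S) ≡ contrib X x S
    contrib-image S = contrib-cong {S = S} {T = image ρ S}
      (mk⇔ (formation-image S) (formation-image⁻ S cx)) (∣image∣ ρ S)

proposition3p1 : ∀ {s n n′} (X : Fin s → Vecℤ n) (Y : Fin s → Vecℤ n′) →
    PairwiseIncomparable X → PairwiseIncomparable Y →
    (ψ : Vecℤ n → Vecℤ n′) →
    (∀ x → InCl X x → InCl Y (ψ x)) →
    (∀ x x′ → InCl X x → InCl X x′ → ψ x ≡ ψ x′ → x ≡ x′) →
    (∀ y → InCl Y y → ∃ λ x → InCl X x × ψ x ≡ y) →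
    (∀ x x′ → InCl X x → InCl X x′ → (x ≤ᵥ x′) ⇔ (ψ x ≤ᵥ ψ x′)) →
    ∀ x → InCl X x → δ Y (ψ x) ≡ δ X x
proposition3p1 X Y incX incY ψ ψ-into ψ-injective ψ-onto ψ-≤⇔ =
  OrderIsomorphism.δ-ψ≡δ incX incY ψ-into ψ-injective ψ-onto ψ-≤⇔
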